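{- Let $M$ be a clutter with non-empty ground set that is connected. Then there is an element $v\in E(M)$ such that either $M\backslash v$ or $M/v$ is a connected clutter.
   Context: A clutter is a pair $(E,\mathcal{A})$ where $E$ is a finite set (the ground set, denoted $E(M)$) and $\mathcal{A}$ is a collection of subsets of $E$ (called rows) such that no row is a subset of a distinct row. For $M=(E,\mathcal{A})$ and $v\in E$, the deletion $M\backslash v$ is the clutter $(E-v,\{A\in\mathcal{A}: v\notin A\})$, and the contraction $M/v$ is the clutter on $E-v$ whose rows are the inclusion-minimal sets among $\{A-v: A\in\mathcal{A}\}$. A separation of a clutter $M$ is a partition of $E(M)$ into two non-empty parts $X,Y$ such that every row is contained in $X$ or in $Y$; $M$ is connected if it has no separation. "Non-empty clutter" means a clutter with non-empty ground set. -}

module Defs where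

open import Data.Nat using (ℕ; suc)
open import Data.Fin using (Fin; punchIn)
open import Data.Fin.Subset using (Subset; _∈_; _∉_; _⊆_; _⊂_; ∁; Nonempty)
open import Data.Fin.Subset.Properties using (_∈?_; _⊂?_)
open import Data.Vec using (tabulate; lookup)
open import Data.List using (List; map; filter)
open import Data.List.Relation.Unary.Any using (any?)
open import Data.List.Membership.Propositional renaming (_∈_ to _∈ₗ_)
open import Data.Product using (_×_)
open import Data.Sum using (_⊎_)
open import Relation.Nullary using (¬_)
open import Relation.Nullary.Decidable using (¬?)
open import Relation.Binary.PropositionalEquality using (_≡_)

Rows : ℕ → Set
Rows n = List (Subset n)

record Clutter (n : ℕ) : Set where
  field
    rows     : Rows n
    clutter  : ∀ {A B} → A ∈ₗ rows → B ∈ₗ rows → A ⊆ B → A ≡ B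
open Clutter public

Separation : ∀ {n} → Rows n → Subset n → Set
Separation {n} R X =
  Nonempty X × Nonempty (∁ X) × (∀ {A} → A ∈ₗ R → A ⊆ X ⊎ A ⊆ ∁ X)

ConnectedRows : ∀ {n} → Rows n → Set
ConnectedRows {n} R = ∀ (X : Subset n) → ¬ Separation R X

Connected : ∀ {n} → Clutter n → Set
Connected M = ConnectedRows (rows M)

-- Restrict a subset of Fin (suc m) to the ground set E - v ≅ Fin m,
-- i.e. A - v, identified via punchIn v.
restrict : ∀ {m} → Fin (suc m) → Subset (suc m) → Subset m
restrict v A = tabulate (λ i → lookup A (punchIn v i))

deletionRows : ∀ {m} → Rows (suc m) → Fin (suc m) → Rows m
deletionRows R v = map (restrict v) (filter (λ A → ¬? (v ∈? A)) R)

contractionRows : ∀ {m} → Rows (suc m) → Fin (suc m) → Rows m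
contractionRows R v =
  filter (λ B → ¬? (any? (λ C → C ⊂? B) S)) S
  where S = map (restrict v) R

-- Fix a root r and, for v ≠ r, let R v be the component of r in the deletion M \ v.  If
-- u ∉ R v then R v ⊆ R u, so choosing v with |R v| maximal gives R u = R v for every u
-- outside R v.  If R v is everything but v, then M \ v is connected.  Otherwise pick
-- u ∉ R v with u ≠ v.  Since M is connected, some row A₀ meets both R v and its
-- complement, and maximality forces A₀ to contain the whole complement of R v.  In M / u
-- the rows inside R v and A₀ - u survive as minimal sets, and together they connect
-- everything, so M / u is connected.
module Submission where

open import Defs
open import Data.Nat using (ℕ; zero; suc; _≤_)
open import Data.Nat.Properties using (<⇒≱)
open import Data.Bool using (Bool; true)
open import Data.Fin using (Fin; zero; suc; punchIn; punchOut; _≟_)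
open import Data.Fin.Properties using (punchIn-punchOut) renaming (any? to anyFin?)
open import Data.Fin.Subset
  using (Subset; _∈_; _∉_; _⊆_; _⊂_; ∁; Nonempty; ∣_∣; _∩_; inside; ⁅_⁆)
open import Data.Fin.Subset.Properties
  using (_∈?_; _⊆?_; _⊂?_; ⊂-irref; nonempty?; anySubset?; p⊂q⇒∣p∣<∣q∣; x∈⁅x⁆; x∈⁅y⁆⇒x≡y;
         x∈p⇒x∉∁p; x∉p⇒x∈∁p; x∈∁p⇒x∉p; x∈p∩q⁺; x∈p∩q⁻)
open import Data.Vec using (tabulate; lookup; insertAt)
open import Data.Vec.Properties
  using (lookup∘tabulate; []=⇒lookup; lookup⇒[]=; insertAt-lookup; insertAt-punchIn)
open import Data.List using (allFin; map; filter)
open import Data.List.Extrema.Nat using (argmax; f[xs]≤f[argmax])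
open import Data.List.Relation.Unary.Any using () renaming (any? to anyList?)
open import Data.List.Relation.Unary.Any.Properties using (map⁻)
open import Data.List.Relation.Unary.All as All using (All)
open import Data.List.Membership.Propositional using (find; lose) renaming (_∈_ to _∈ₗ_)
open import Data.List.Membership.Propositional.Properties
  using (∈-map⁺; ∈-filter⁺; ∈-filter⁻; ∈-allFin)
open import Data.Product using (∃; _×_; _,_; proj₁; proj₂)
open import Data.Sum using (_⊎_; inj₁; inj₂; [_,_]′)
open import Data.Empty using (⊥-elim)
open import Function using (_∘_)
open import Relation.Nullary using (¬_; Dec; yes; no; does)
open import Relation.Nullary.Decidable
  using (_×-dec_; _→-dec_; ¬?; map′; decidable-stable; dec-true)
open import Relation.Binary.PropositionalEquality using (_≡_; _≢_; refl; sym; trans; subst; cong)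

module _ {n : ℕ} where

  ∈-tabulate⁺ : ∀ (f : Fin n → Bool) {x} → f x ≡ true → x ∈ tabulate f
  ∈-tabulate⁺ f {x} fx = lookup⇒[]= x (tabulate f) (trans (lookup∘tabulate f x) fx)

  ∈-tabulate⁻ : ∀ (f : Fin n → Bool) {x} → x ∈ tabulate f → f x ≡ true
  ∈-tabulate⁻ f {x} x∈ = trans (sym (lookup∘tabulate f x)) ([]=⇒lookup x∈)

  fromDec : {P : Fin n → Set} → ((x : Fin n) → Dec (P x)) → Subset n
  fromDec P? = tabulate (λ x → does (P? x))

  ∈-fromDec⁺ : {P : Fin n → Set} (P? : (x : Fin n) → Dec (P x)) {x : Fin n} →
               P x → x ∈ fromDec P?
  ∈-fromDec⁺ P? {x} px = ∈-tabulate⁺ (λ y → does (P? y)) (dec-true (P? x) px)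

  ∈-fromDec⁻ : {P : Fin n → Set} (P? : (x : Fin n) → Dec (P x)) {x : Fin n} →
               x ∈ fromDec P? → P x
  ∈-fromDec⁻ P? {x} x∈ with P? x | ∈-tabulate⁻ (λ y → does (P? y)) x∈
  ... | yes px | _  = px
  ... | no _   | ()

module _ {m : ℕ} where

  punchIn-onto : ∀ (w y : Fin (suc m)) → y ≢ w → ∃ λ i → punchIn w i ≡ y
  punchIn-onto w y y≢w = punchOut (y≢w ∘ sym) , punchIn-punchOut (y≢w ∘ sym)

  ∈-restrict⁺ : ∀ (w : Fin (suc m)) A {i} → punchIn w i ∈ A → i ∈ restrict w A
  ∈-restrict⁺ w A h = ∈-tabulate⁺ (lookup A ∘ punchIn w) ([]=⇒lookup h)

  ∈-restrict⁻ : ∀ (w : Fin (suc m)) A {i} → i ∈ restrict w A → punchIn w i ∈ A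
  ∈-restrict⁻ w A {i} h = lookup⇒[]= (punchIn w i) A (∈-tabulate⁻ (lookup A ∘ punchIn w) h)

  restrict-⊆⇒∈ : ∀ {w : Fin (suc m)} {A B x} → restrict w B ⊆ restrict w A → x ∈ B → x ≢ w → x ∈ A
  restrict-⊆⇒∈ {w} {A} {B} B⊆A x∈B x≢w with punchIn-onto w _ x≢w
  ... | i , refl = ∈-restrict⁻ w A (B⊆A (∈-restrict⁺ w B x∈B))

  restrict-⊆⇒⊆ : ∀ {w : Fin (suc m)} {A B} → (w ∈ B → w ∈ A) → restrict w B ⊆ restrict w A → B ⊆ A
  restrict-⊆⇒⊆ {w} w∈A B⊆A {x} x∈B with x ≟ w
  ... | yes refl = w∈A x∈B
  ... | no x≢w = restrict-⊆⇒∈ B⊆A x∈B x≢w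

  -- The subset Z ∪ {w} of Fin (suc m), where Fin m is identified with Fin (suc m) - w.
  expand : Fin (suc m) → Subset m → Subset (suc m)
  expand w Z = insertAt Z w inside

  ∈-expand-self : ∀ w Z → w ∈ expand w Z
  ∈-expand-self w Z = lookup⇒[]= w (expand w Z) (insertAt-lookup Z w inside)

  ∈-expand⁺ : ∀ w Z {i} → i ∈ Z → punchIn w i ∈ expand w Z
  ∈-expand⁺ w Z {i} i∈Z =
    lookup⇒[]= (punchIn w i) (expand w Z) (trans (insertAt-punchIn Z w inside i) ([]=⇒lookup i∈Z))

  ∈-expand⁻ : ∀ w Z {i} → punchIn w i ∈ expand w Z → i ∈ Z
  ∈-expand⁻ w Z {i} h =
    lookup⇒[]= i Z (trans (sym (insertAt-punchIn Z w inside i)) ([]=⇒lookup h))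

  restrict-⊆⇒⊆-expand : ∀ {w : Fin (suc m)} {A Z} → restrict w A ⊆ Z → A ⊆ expand w Z
  restrict-⊆⇒⊆-expand {w} {A} {Z} A⊆Z {y} y∈A with y ≟ w
  ... | yes refl = ∈-expand-self w Z
  ... | no y≢w with punchIn-onto w y y≢w
  ...   | i , refl = ∈-expand⁺ w Z (A⊆Z (∈-restrict⁺ w A y∈A))

-- Closed sets and components of a family of rows

module _ {n : ℕ} where

  -- Closed sets are the unions of connected components.
  Closed : Rows n → Subset n → Set
  Closed F Z = ∀ {A} → A ∈ₗ F → ∀ {x} → x ∈ A → x ∈ Z → A ⊆ Z

  closed? : ∀ F Z → Dec (Closed F Z)
  closed? F Z = map′ fromAll toAll (All.all? (λ A → nonempty? (A ∩ Z) →-dec A ⊆? Z) F)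
    where
    fromAll : All (λ A → Nonempty (A ∩ Z) → A ⊆ Z) F → Closed F Z
    fromAll all A∈ x∈A x∈Z = All.lookup all A∈ (_ , x∈p∩q⁺ (x∈A , x∈Z))
    toAll : Closed F Z → All (λ A → Nonempty (A ∩ Z) → A ⊆ Z) F
    toAll closed = All.tabulate λ A∈ (_ , x∈A∩Z) →
      let x∈A , x∈Z = x∈p∩q⁻ _ Z x∈A∩Z in closed A∈ x∈A x∈Z

  separation⇒closed : ∀ {F X} → (∀ {A} → A ∈ₗ F → A ⊆ X ⊎ A ⊆ ∁ X) →
                      Closed F X × Closed F (∁ X)
  separation⇒closed split =
    (λ A∈ x∈A x∈X → case-X (split A∈) x∈A x∈X) , (λ A∈ x∈A x∈∁X → case-∁X (split A∈) x∈A x∈∁X)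
    where
    case-X : ∀ {A X x} → A ⊆ X ⊎ A ⊆ ∁ X → x ∈ A → x ∈ X → A ⊆ X
    case-X (inj₁ A⊆X) _   _   = A⊆X
    case-X (inj₂ A⊆∁X) x∈A x∈X = ⊥-elim (x∈p⇒x∉∁p x∈X (A⊆∁X x∈A))
    case-∁X : ∀ {A X x} → A ⊆ X ⊎ A ⊆ ∁ X → x ∈ A → x ∈ ∁ X → A ⊆ ∁ X
    case-∁X (inj₁ A⊆X) x∈A x∈∁X = ⊥-elim (x∈∁p⇒x∉p x∈∁X (A⊆X x∈A))
    case-∁X (inj₂ A⊆∁X) _   _   = A⊆∁X

  connected-if-closed-full : ∀ {F} (p : Fin n) →
    (∀ Z → Closed F Z → p ∈ Z → ∀ x → x ∈ Z) → ConnectedRows F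
  connected-if-closed-full p full X ((x , x∈X) , (y , y∈∁X) , split)
    with p ∈? X | separation⇒closed split
  ... | yes p∈X | X-closed , _ = x∈p⇒x∉∁p (full X X-closed p∈X y) y∈∁X
  ... | no p∉X  | _ , ∁X-closed = x∈p⇒x∉∁p x∈X (full (∁ X) ∁X-closed (x∉p⇒x∈∁p p∉X) x)

  Crosses : Subset n → Subset n → Set
  Crosses A Z = Nonempty (A ∩ Z) × Nonempty (A ∩ ∁ Z)

  crossing-row : ∀ {F Z} → ConnectedRows F → Nonempty Z → Nonempty (∁ Z) →
                 ∃ λ A → A ∈ₗ F × Crosses A Z
  crossing-row {F} {Z} conn neZ ne∁Z
    with anyList? (λ A → nonempty? (A ∩ Z) ×-dec nonempty? (A ∩ ∁ Z)) F
  ... | yes crossing = find crossing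
  ... | no ¬crossing = ⊥-elim (conn Z (neZ , ne∁Z , split))
    where
    split : ∀ {A} → A ∈ₗ F → A ⊆ Z ⊎ A ⊆ ∁ Z
    split {A} A∈ with nonempty? (A ∩ ∁ Z)
    ... | yes meets∁Z = inj₂ λ x∈A → x∉p⇒x∈∁p λ x∈Z →
            ¬crossing (lose A∈ ((_ , x∈p∩q⁺ (x∈A , x∈Z)) , meets∁Z))
    ... | no ¬meets∁Z = inj₁ λ {x} x∈A → decidable-stable (x ∈? Z) λ x∉Z →
            ¬meets∁Z (x , x∈p∩q⁺ (x∈A , x∉p⇒x∈∁p x∉Z))

  InComponent : Rows n → Fin n → Fin n → Set
  InComponent F p x = ∀ Z → Closed F Z → p ∈ Z → x ∈ Z

  inComponent? : ∀ F p x → Dec (InComponent F p x)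
  inComponent? F p x with anySubset? (λ Z → closed? F Z ×-dec (p ∈? Z ×-dec ¬? (x ∈? Z)))
  ... | yes (Z , closed , p∈Z , x∉Z) = no λ inAll → x∉Z (inAll Z closed p∈Z)
  ... | no ¬witness = yes λ Z closed p∈Z →
          decidable-stable (x ∈? Z) λ x∉Z → ¬witness (Z , closed , p∈Z , x∉Z)

  -- Kept abstract: unfolding the search over all subsets makes typechecking blow up.
  abstract
    component : Rows n → Fin n → Subset n
    component F p = fromDec (inComponent? F p)

    component-least : ∀ {F p Z} → Closed F Z → p ∈ Z → component F p ⊆ Z
    component-least {F} {p} closed p∈Z x∈ = ∈-fromDec⁻ (inComponent? F p) x∈ _ closed p∈Z

    component-∋ : ∀ {F p} → p ∈ component F p
    component-∋ {F} {p} = ∈-fromDec⁺ (inComponent? F p) λ Z closed p∈Z → p∈Z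

    component-closed : ∀ {F p} → Closed F (component F p)
    component-closed {F} {p} A∈ x∈A x∈C y∈A = ∈-fromDec⁺ (inComponent? F p) λ Z closed p∈Z →
      closed A∈ x∈A (component-least closed p∈Z x∈C) y∈A

expand-closed : ∀ {m} {G : Rows m} {Z w A x} → Closed G Z → restrict w A ∈ₗ G →
  x ∈ A → x ≢ w → x ∈ expand w Z → A ⊆ expand w Z
expand-closed {Z = Z} {w} {A} closedZ rA∈ x∈A x≢w x∈Z⁺ with punchIn-onto w _ x≢w
... | i , refl = restrict-⊆⇒⊆-expand (closedZ rA∈ (∈-restrict⁺ w A x∈A) (∈-expand⁻ w Z x∈Z⁺))

component-⊆-expand : ∀ {m} {F : Rows (suc m)} {G : Rows m} {r w Z} →
  w ∉ component F r →
  (∀ {A} → A ∈ₗ F → A ⊆ component F r → restrict w A ∈ₗ G) →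
  Closed G Z → r ∈ expand w Z → component F r ⊆ expand w Z
component-⊆-expand {F = F} {r = r} {w} {Z} w∉C survives closedZ r∈Z⁺ x∈C =
  proj₂ (x∈p∩q⁻ C (expand w Z) (component-least closed (x∈p∩q⁺ (component-∋ , r∈Z⁺)) x∈C))
  where
  C = component F r
  closed : Closed F (C ∩ expand w Z)
  closed {A} A∈ {x} x∈A x∈Y y∈A =
    let x∈C , x∈Z⁺ = x∈p∩q⁻ C (expand w Z) x∈Y
        A⊆C = component-closed A∈ x∈A x∈C
        x≢w = λ x≡w → w∉C (subst (_∈ C) x≡w x∈C)
    in x∈p∩q⁺ (A⊆C y∈A , expand-closed closedZ (survives A∈ A⊆C) x∈A x≢w x∈Z⁺ y∈A)

connected-if-expand-full : ∀ {m} {G : Rows m} (r w : Fin (suc m)) → r ≢ w →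
  (∀ Z → Closed G Z → r ∈ expand w Z → ∀ y → y ∈ expand w Z) → ConnectedRows G
connected-if-expand-full r w r≢w full with punchIn-onto w r r≢w
... | p , refl = connected-if-closed-full p λ Z closed p∈Z i →
  ∈-expand⁻ w Z (full Z closed (∈-expand⁺ w Z p∈Z) (punchIn w i))

-- Components of deletions

avoiding : ∀ {n} → Fin n → Rows n → Rows n
avoiding v = filter (λ A → ¬? (v ∈? A))

∈-avoiding⁺ : ∀ {n} {v : Fin n} {F A} → A ∈ₗ F → v ∉ A → A ∈ₗ avoiding v F
∈-avoiding⁺ {v = v} = ∈-filter⁺ (λ A → ¬? (v ∈? A))

∈-avoiding⁻ : ∀ {n} {v : Fin n} {F A} → A ∈ₗ avoiding v F → A ∈ₗ F × v ∉ A
∈-avoiding⁻ {v = v} {F} = ∈-filter⁻ (λ A → ¬? (v ∈? A)) {xs = F}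

module DeletionComponents {m : ℕ} (F : Rows (suc m)) (r : Fin (suc m)) where

  -- The component of r in F \ v, kept as a subset of the whole ground set.
  R : Fin (suc m) → Subset (suc m)
  R v = component (avoiding v F) r

  R-closed : ∀ {v A x} → A ∈ₗ F → v ∉ A → x ∈ A → x ∈ R v → A ⊆ R v
  R-closed A∈ v∉A = component-closed (∈-avoiding⁺ A∈ v∉A)

  R-∌ : ∀ {v} → r ≢ v → v ∉ R v
  R-∌ {v} r≢v v∈R = x∈∁p⇒x∉p (component-least avoids r∈∁⁅v⁆ v∈R) (x∈⁅x⁆ v)
    where
    r∈∁⁅v⁆ : r ∈ ∁ ⁅ v ⁆
    r∈∁⁅v⁆ = x∉p⇒x∈∁p (r≢v ∘ x∈⁅y⁆⇒x≡y v)
    avoids : Closed (avoiding v F) (∁ ⁅ v ⁆)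
    avoids A∈ _ _ {y} y∈A = x∉p⇒x∈∁p λ y∈⁅v⁆ →
      proj₂ (∈-avoiding⁻ {F = F} A∈) (subst (_∈ _) (x∈⁅y⁆⇒x≡y v y∈⁅v⁆) y∈A)

  R-⊆ : ∀ {u v} → u ∉ R v → R v ⊆ R u
  R-⊆ {u} {v} u∉Rv x∈Rv =
    proj₂ (x∈p∩q⁻ (R v) (R u) (component-least closed (x∈p∩q⁺ (component-∋ , component-∋)) x∈Rv))
    where
    closed : Closed (avoiding v F) (R v ∩ R u)
    closed A∈ x∈A x∈Y y∈A with ∈-avoiding⁻ A∈ | x∈p∩q⁻ (R v) (R u) x∈Y
    ... | A∈F , v∉A | x∈Rv , x∈Ru =
      let A⊆Rv = R-closed A∈F v∉A x∈A x∈Rv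
      in x∈p∩q⁺ (A⊆Rv y∈A , R-closed A∈F (u∉Rv ∘ A⊆Rv) x∈A x∈Ru y∈A)

  deletion-connected : ∀ {v} → r ≢ v → (∀ y → y ≢ v → y ∈ R v) → ConnectedRows (deletionRows F v)
  deletion-connected {v} r≢v covers = connected-if-expand-full r v r≢v full
    where
    full : ∀ Z → Closed (deletionRows F v) Z → r ∈ expand v Z → ∀ y → y ∈ expand v Z
    full Z closed r∈Z⁺ y with y ≟ v
    ... | yes refl = ∈-expand-self v Z
    ... | no y≢v = component-⊆-expand (R-∌ r≢v) (λ A∈ _ → ∈-map⁺ (restrict v) A∈) closed r∈Z⁺
                     (covers y y≢v)

-- Contractions of clutters

module _ {m : ℕ} (M : Clutter (suc m)) where

  contraction-row : ∀ {u A} → A ∈ₗ rows M →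
    (∀ {B} → B ∈ₗ rows M → u ∈ B → ¬ (restrict u B ⊂ restrict u A)) →
    restrict u A ∈ₗ contractionRows (rows M) u
  contraction-row {u} {A} A∈ minimal =
    ∈-filter⁺ (λ B → ¬? (anyList? (_⊂? B) (map (restrict u) (rows M))))
      (∈-map⁺ (restrict u) A∈) (λ smaller → let _ , B∈ , B⊂A = find (map⁻ smaller) in not-smaller B∈ B⊂A)
    where
    not-smaller : ∀ {B} → B ∈ₗ rows M → ¬ (restrict u B ⊂ restrict u A)
    not-smaller {B} B∈ B⊂A with u ∈? B
    ... | yes u∈B = minimal B∈ u∈B B⊂A
    ... | no u∉B = ⊂-irref (cong (restrict u) (clutter M B∈ A∈ B⊆A)) B⊂A
      where B⊆A = restrict-⊆⇒⊆ (⊥-elim ∘ u∉B) (proj₁ B⊂A)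

  contraction-row-∋ : ∀ {u A} → A ∈ₗ rows M → u ∈ A → restrict u A ∈ₗ contractionRows (rows M) u
  contraction-row-∋ A∈ u∈A = contraction-row A∈ λ B∈ _ B⊂A →
    ⊂-irref (cong (restrict _) (clutter M B∈ A∈ (restrict-⊆⇒⊆ (λ _ → u∈A) (proj₁ B⊂A)))) B⊂A

-- A deletion component of maximum size

module MaximalComponent {m : ℕ} (M : Clutter (suc m)) (conn : Connected M)
  (r v : Fin (suc m)) (r≢v : r ≢ v) where

  open DeletionComponents (rows M) r

  module _ (maximal : ∀ t → r ≢ t → ∣ R t ∣ ≤ ∣ R v ∣) where

    outside-R-⊆ : ∀ {t} → t ∉ R v → R t ⊆ R v
    outside-R-⊆ {t} t∉Rv {x} x∈Rt with x ∈? R v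
    ... | yes x∈Rv = x∈Rv
    ... | no x∉Rv = ⊥-elim (<⇒≱ (p⊂q⇒∣p∣<∣q∣ (R-⊆ t∉Rv , x , x∈Rt , x∉Rv)) (maximal t r≢t))
      where
      r≢t : r ≢ t
      r≢t refl = t∉Rv component-∋

    crossing-⊇-outside : ∀ {A t} → A ∈ₗ rows M → Crosses A (R v) → t ∉ R v → t ∈ A
    crossing-⊇-outside {A} {t} A∈ ((x , x∈A∩Rv) , (y , y∈A∩∁Rv)) t∉Rv with t ∈? A
    ... | yes t∈A = t∈A
    ... | no t∉A =
      let x∈A , x∈Rv = x∈p∩q⁻ A (R v) x∈A∩Rv
          y∈A , y∈∁Rv = x∈p∩q⁻ A (∁ (R v)) y∈A∩∁Rv
          A⊆Rt = R-closed A∈ t∉A x∈A (R-⊆ t∉Rv x∈Rv)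
      in ⊥-elim (x∈∁p⇒x∉p y∈∁Rv (outside-R-⊆ t∉Rv (A⊆Rt y∈A)))

    contraction-connected : ∀ {u} → u ∉ R v → u ≢ v → ConnectedRows (contractionRows (rows M) u)
    contraction-connected {u} u∉Rv u≢v
      with crossing-row conn (r , component-∋) (v , x∉p⇒x∈∁p (R-∌ r≢v))
    ... | A₀ , A₀∈ , A₀-crosses@((x₀ , x₀∈A₀∩Rv) , _) = connected-if-expand-full r u r≢u full
      where
      r≢u : r ≢ u
      r≢u refl = u∉Rv component-∋

      x₀∈A₀ = proj₁ (x∈p∩q⁻ A₀ (R v) x₀∈A₀∩Rv)
      x₀∈Rv = proj₂ (x∈p∩q⁻ A₀ (R v) x₀∈A₀∩Rv)
      u∈A₀ = crossing-⊇-outside A₀∈ A₀-crosses u∉Rv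

      -- A row with no point besides u lies inside A₀, so by the clutter property it is A₀.
      rows-through-u-meet-Rv : ∀ {B} → B ∈ₗ rows M → (∀ {x} → x ∈ B → x ≢ u → x ∈ R v) →
                               ∃ λ x → x ∈ B × x ∈ R v
      rows-through-u-meet-Rv {B} B∈ B∖u⊆Rv with anyFin? (λ x → x ∈? B ×-dec ¬? (x ≟ u))
      ... | yes (x , x∈B , x≢u) = x , x∈B , B∖u⊆Rv x∈B x≢u
      ... | no ¬other = x₀ , subst (x₀ ∈_) (sym (clutter M B∈ A₀∈ B⊆A₀)) x₀∈A₀ , x₀∈Rv
        where
        B⊆A₀ : B ⊆ A₀
        B⊆A₀ {z} z∈B with z ≟ u
        ... | yes refl = u∈A₀
        ... | no z≢u = ⊥-elim (¬other (z , z∈B , z≢u))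

      inner-row-survives : ∀ {A} → A ∈ₗ rows M → A ⊆ R v → restrict u A ∈ₗ contractionRows (rows M) u
      inner-row-survives {A} A∈ A⊆Rv = contraction-row M A∈ λ {B} B∈ u∈B B⊂A →
        let B∖u⊆Rv : ∀ {x} → x ∈ B → x ≢ u → x ∈ R v
            B∖u⊆Rv x∈B x≢u = A⊆Rv (restrict-⊆⇒∈ (proj₁ B⊂A) x∈B x≢u)
            v∉B : v ∉ B
            v∉B v∈B = R-∌ r≢v (B∖u⊆Rv v∈B (u≢v ∘ sym))
            x , x∈B , x∈Rv = rows-through-u-meet-Rv B∈ B∖u⊆Rv
        in u∉Rv (R-closed B∈ v∉B x∈B x∈Rv u∈B)

      Rv∪A₀-covers : ∀ y → y ∈ R v ⊎ y ∈ A₀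
      Rv∪A₀-covers y with y ∈? R v
      ... | yes y∈Rv = inj₁ y∈Rv
      ... | no y∉Rv = inj₂ (crossing-⊇-outside A₀∈ A₀-crosses y∉Rv)

      full : ∀ Z → Closed (contractionRows (rows M) u) Z → r ∈ expand u Z → ∀ y → y ∈ expand u Z
      full Z closed r∈Z⁺ y = [ Rv⊆Z⁺ , A₀⊆Z⁺ ]′ (Rv∪A₀-covers y)
        where
        Rv⊆Z⁺ = component-⊆-expand u∉Rv (inner-row-survives ∘ proj₁ ∘ ∈-avoiding⁻) closed r∈Z⁺
        x₀≢u = λ x₀≡u → u∉Rv (subst (_∈ R v) x₀≡u x₀∈Rv)
        A₀⊆Z⁺ = expand-closed closed (contraction-row-∋ M A₀∈ u∈A₀) x₀∈A₀ x₀≢u (Rv⊆Z⁺ x₀∈Rv)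

    deletion-or-contraction-connected : ∃ λ w →
      ConnectedRows (deletionRows (rows M) w) ⊎ ConnectedRows (contractionRows (rows M) w)
    deletion-or-contraction-connected with anyFin? (λ u → ¬? (u ∈? R v) ×-dec ¬? (u ≟ v))
    ... | yes (u , u∉Rv , u≢v) = u , inj₂ (contraction-connected u∉Rv u≢v)
    ... | no ¬outside = v , inj₁ (deletion-connected r≢v λ y y≢v →
            decidable-stable (y ∈? R v) λ y∉Rv → ¬outside (y , y∉Rv , y≢v))

maximum-attained : ∀ {k} (f : Fin (suc k) → ℕ) → ∃ λ j → ∀ i → f i ≤ f j
maximum-attained f = j , λ i → All.lookup (f[xs]≤f[argmax] {f = f} zero (allFin _)) (∈-allFin i)
  where j = argmax f zero (allFin _)

mainTheorem2 : (m : ℕ) (M : Clutter (suc m)) → Connected M →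
    ∃ λ (v : Fin (suc m)) →
      ConnectedRows (deletionRows (rows M) v) ⊎ ConnectedRows (contractionRows (rows M) v)
mainTheorem2 zero M conn = zero , inj₁ λ { _ ((() , _) , _) }
mainTheorem2 (suc m) M conn =
  MaximalComponent.deletion-or-contraction-connected M conn zero (suc j) (λ ()) maximal
  where
  open DeletionComponents (rows M) zero
  largest = maximum-attained (λ i → ∣ R (suc i) ∣)
  j = proj₁ largest
  maximal : ∀ t → zero ≢ t → ∣ R t ∣ ≤ ∣ R (suc j) ∣
  maximal zero 0≢0 = ⊥-elim (0≢0 refl)
  maximal (suc t) _ = proj₂ largest t
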